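{- Let $D$ be an eulerian digraph with $n$ vertices and $m$ arcs. If $D$ has a directed embedding with $t$ faces, then $D$ has a nonorientable directed embedding with $s$ faces for every $s$ with $1\le s<t$; consequently, the set of genera for which $D$ has a nonorientable directed embedding is a (possibly empty) interval of integers. If $D$ has no arcs, then $D$ has exactly one directed embedding, which is planar with exactly one face. If $D$ has at least one arc, then $D$ has at least one directed embedding with exactly one face, every such embedding is nonorientable, and every such embedding has maximum genus, namely $m-n+1$, over all nonorientable directed embeddings of $D$, and also maximum Euler genus over all directed embeddings of $D$.
   Context: Digraphs are finite and may have loops and multiple arcs. A digraph is eulerian if it has a directed circuit using every arc and every vertex. Embeddings are cellular in closed surfaces. A directed embedding of a digraph is an embedding in which every face is bounded by a directed closed walk. The Euler genus of a surface is its genus if nonorientable and twice its genus if orientable. -}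

module Defs where

open import Data.Nat using (ℕ; zero; suc; _+_)
open import Data.Fin using (Fin; _≟_)
open import Data.Bool using (Bool; not; _∨_; if_then_else_)
open import Data.Product using (Σ; _×_; _,_; proj₁; ∃-syntax)
open import Data.Sum using (_⊎_)
open import Data.List using (List; []; _∷_; allFin; length; filterᵇ)
open import Data.Bool using (true; _∧_)
open import Relation.Nullary using (¬_)
open import Data.List.Relation.Unary.Any using (Any)
open import Data.List.Relation.Binary.Permutation.Propositional using (_↭_)
open import Relation.Binary.PropositionalEquality using (_≡_; _≢_)
open import Relation.Binary.Construct.Closure.ReflexiveTransitive using (Star)
open import Relation.Nullary.Decidable using (⌊_⌋)
open import Data.Integer as ℤ using (ℤ; +_)

record Digraph (n m : ℕ) : Set where
  field
    tail head : Fin m → Fin n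

allᵇ : {A : Set} → (A → Bool) → List A → Bool
allᵇ p []       = true
allᵇ p (x ∷ xs) = p x ∧ allᵇ p xs

iter : {A : Set} → (A → A) → ℕ → A → A
iter f zero    x = x
iter f (suc k) x = f (iter f k x)

-- The two sides of an arc (labelling of the two sides is arbitrary).
Side : ℕ → Set
Side m = Fin m × Bool

arcOf : {m : ℕ} → Side m → Fin m
arcOf = proj₁

flipSide : {m : ℕ} → Side m → Side m
flipSide (e , b) = (e , not b)

-- A corner (in-arc side x followed
-- by out-arc side φ x) is identified with its in-side x.  Consecutive
-- corners around the vertex share either the in-arc (other side) or the
-- out-arc (other side).
CornerStep : {m : ℕ} → (Side m → Side m) → (Side m → Side m) → Side m → Side m → Set
CornerStep φ ψ x y = y ≡ flipSide x ⊎ y ≡ ψ (flipSide (φ x))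

module _ {n m : ℕ} (D : Digraph n m) where
  open Digraph D

  WalkFromTo : Fin n → List (Fin m) → Fin n → Set
  WalkFromTo v []      u = v ≡ u
  WalkFromTo v (e ∷ w) u = tail e ≡ v × WalkFromTo (head e) w u

  Eulerian : Set
  Eulerian = Σ (Fin n) λ v₀ → Σ (List (Fin m)) λ w →
    WalkFromTo v₀ w v₀ × (w ↭ allFin m)
      × (∀ u → u ≡ v₀ ⊎ Any (λ e → head e ≡ u) w)

  -- Combinatorial directed embedding: the faces are polygons whose boundaries
  -- are directed closed walks, glued along the arcs.  φ x is the side of the
  -- next arc along the face boundary through side x; ψ is its inverse.
  -- vertexDisk says that the corners at each vertex form a single cycle,
  -- i.e. the neighbourhood of every vertex is a disk (so the glued space is
  -- a closed surface).
  record DirectedEmbedding : Set where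
    field
      φ ψ        : Side m → Side m
      φψ         : ∀ x → φ (ψ x) ≡ x
      ψφ         : ∀ x → ψ (φ x) ≡ x
      directed   : ∀ x → head (arcOf x) ≡ tail (arcOf (φ x))
      vertexDisk : ∀ v x y → head (arcOf x) ≡ v → head (arcOf y) ≡ v →
                   Star (CornerStep φ ψ) x y
  open DirectedEmbedding public

  -- two embeddings are the same iff they differ by relabelling the sides of
  -- some arcs
  switch : (Fin m → Bool) → Side m → Side m
  switch σ (e , b) = (e , (if σ e then not b else b))

  SameEmbedding : DirectedEmbedding → DirectedEmbedding → Set
  SameEmbedding E E' = Σ (Fin m → Bool) λ σ →
    ∀ x → φ E' x ≡ switch σ (φ E (switch σ x))

  isIsolated : Fin n → Bool
  isIsolated v = allᵇ (λ e → not (⌊ tail e ≟ v ⌋ ∨ ⌊ head e ≟ v ⌋)) (allFin m)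

  isolatedCount : ℕ
  isolatedCount = length (filterᵇ isIsolated (allFin n))

  FaceOrbits : DirectedEmbedding → ℕ → Set
  FaceOrbits E k = Σ (Side m → Fin k) λ f →
    (∀ x y → (f x ≡ f y → ∃[ j ] iter (φ E) j x ≡ y)
           × (∃[ j ] iter (φ E) j x ≡ y → f x ≡ f y))
    × (∀ i → ∃[ x ] f x ≡ i)

  -- E has exactly t faces (an isolated vertex alone forms a sphere with one face)
  HasFaces : DirectedEmbedding → ℕ → Set
  HasFaces E t = Σ ℕ λ k → FaceOrbits E k × t ≡ k + isolatedCount

  -- the surface is orientable iff the polygons can be oriented so that every
  -- arc receives opposite orientations from its two sides; since both sides
  -- traverse the arc in its own direction this means a 2-colouring of the
  -- faces with the two sides of each arc coloured differently
  Orientable : DirectedEmbedding → Set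
  Orientable E = Σ (Side m → Bool) λ c →
    (∀ x → c (φ E x) ≡ c x) × (∀ x → c (flipSide x) ≢ c x)

  -- Euler genus of an embedding with t faces: 2 - χ, χ = n - m + t
  eulerGenus : ℕ → ℤ
  eulerGenus t = + (2 + m) ℤ.- + (n + t)

  nonorientableGenus : ℕ → ℤ
  nonorientableGenus t = eulerGenus t

  Planar : DirectedEmbedding → ℕ → Set
  Planar E t = Orientable E × eulerGenus t ≡ + 0

  HasNonorientableGenus : ℤ → Set
  HasNonorientableGenus g = Σ DirectedEmbedding λ E → Σ ℕ λ t →
    HasFaces E t × (¬ Orientable E) × nonorientableGenus t ≡ g

{-# OPTIONS --safe #-}
-- If there
-- are two or more faces, the Euler circuit passes through an arc whose two sides lie on different faces;
-- twisting that arc (precomposing φ with the transposition of its sides) merges these two faces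
-- into one containing both sides of the arc, which rules out a face 2-colouring, so the result is
-- nonorientable.  Iterating lowers the number of faces one at a time down to 1.  A first embedding
-- comes from the Euler circuit: one side of every arc follows the circuit, the other follows it
-- after rotating the in-arcs at each vertex.  As the Euler genus is 2 - n + m - t, fewer faces
-- means larger genus, which gives the interval property and the maximality of one-face
-- embeddings.  Without arcs the digraph is a single vertex, embedded in the sphere.
module Submission where

open import Defs
open import Data.Bool using (Bool; true; false; not; _∨_; T)
open import Data.Bool.Properties using (T?; not-involutive)
open import Data.Empty using (⊥-elim)
open import Data.Fin as Fin using (Fin; zero; suc; toℕ; fromℕ<; punchOut; punchIn; _↑ˡ_; _↑ʳ_; splitAt)
open import Data.Fin.Properties
  using (punchOut-cong; punchOut-injective; punchInᵢ≢i; punchOut-punchIn; pigeonhole; any?; toℕ-fromℕ<;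
         splitAt-↑ˡ; splitAt-↑ʳ; 0≢1+n; toℕ<n)
open import Data.Integer as ℤ using (ℤ; +_; ∣_∣)
import Data.Integer.Properties as ℤₚ
open import Data.Integer.Tactic.RingSolver using (solve-∀)
open import Data.List using (List; []; _∷_; map; allFin; length)
open import Data.List.Properties using (filter-none)
open import Data.List.Membership.Propositional using (_∈_; _∉_)
open import Data.List.Membership.Propositional.Properties using (∈-map⁺; ∈-allFin)
open import Data.List.Relation.Binary.Permutation.Propositional using (_↭_; ↭-sym; ↭⇒↭ₛ)
open import Data.List.Relation.Binary.Permutation.Propositional.Properties using (∈-resp-↭; ↭-empty-inv)
import Data.List.Relation.Binary.Permutation.Setoid.Properties as ↭ₛ
import Data.List.Relation.Unary.All as All
open import Data.List.Relation.Unary.All.Properties using (All¬⇒¬Any)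
open import Data.List.Relation.Unary.AllPairs using (_∷_)
open import Data.List.Relation.Unary.Any using (here; there; satisfied)
open import Data.List.Relation.Unary.Unique.Propositional using (Unique)
open import Data.List.Relation.Unary.Unique.Propositional.Properties using (allFin⁺)
open import Data.Nat using (ℕ; zero; suc; _+_; _*_; _≤_; _<_; _≥_; z≤n; s≤s)
open import Data.Nat.DivMod using (_%_; _/_; m≡m%n+[m/n]*n; m%n<n)
open import Data.Nat.Properties
  using (+-comm; +-suc; *-suc; +-identityʳ; n<1+n; m≤m+n; ≤-refl; ≤-trans; _≤?_; ≰⇒>;
         m≤n⇒∃[o]m+o≡n; m≤n⇒m<n∨m≡n)
open import Data.Product using (Σ; _×_; _,_; proj₁; proj₂; ∃-syntax)
open import Data.Sum using (_⊎_; inj₁; inj₂; [_,_]′)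
open import Data.Unit using (⊤; tt)
open import Function using (_∘_)
open import Function.Bundles using (_↩_; mk↩; module LeftInverse)
open import Function.Consequences.Propositional using (strictlyInverseˡ⇒inverseˡ)
open import Function.Construct.Identity using (↩-id)
open import Relation.Binary.Construct.Closure.ReflexiveTransitive using (Star; ε; _◅_; _◅◅_; fold; _⋆)
open import Relation.Binary.Definitions using (DecidableEquality)
open import Relation.Binary.PropositionalEquality
open import Relation.Binary.Structures using (IsDecEquivalence)
open import Relation.Nullary using (¬_; ¬?; Dec; yes; no)
open import Relation.Nullary.Decidable using (map′; decidable-stable; ⌊_⌋)

Reach : {A : Set} → (A → A) → A → A → Set
Reach p a b = ∃[ j ] iter p j a ≡ b

Classification : {A : Set} → (A → A → Set) → ℕ → Set
Classification {A} _~_ k = Σ (A → Fin k) λ f →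
  (∀ x y → (f x ≡ f y → x ~ y) × (x ~ y → f x ≡ f y)) × (∀ i → ∃[ x ] f x ≡ i)

-- FaceOrbits D E is definitionally Orbits (φ E).
Orbits : {A : Set} → (A → A) → ℕ → Set
Orbits p = Classification (Reach p)

module _ {A : Set} where

  iter-+ : ∀ (p : A → A) i j a → iter p (i + j) a ≡ iter p i (iter p j a)
  iter-+ p zero    j a = refl
  iter-+ p (suc i) j a = cong p (iter-+ p i j a)

  iter-suc : ∀ (p : A → A) j a → iter p (suc j) a ≡ iter p j (p a)
  iter-suc p j a = trans (cong (λ i → iter p i a) (+-comm 1 j)) (iter-+ p j 1 a)

  reach-refl : ∀ {p : A → A} {a} → Reach p a a
  reach-refl = 0 , refl

  reach-step : ∀ {p : A → A} {a b} → p a ≡ b → Reach p a b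
  reach-step e = 1 , e

  reach-trans : ∀ {p : A → A} {a b c} → Reach p a b → Reach p b c → Reach p a c
  reach-trans {p} {a} (i , refl) (j , refl) = j + i , iter-+ p j i a

  reach-invariant : ∀ {p : A → A} {X : Set} (g : A → X) → (∀ z → g (p z) ≡ g z) →
                    ∀ {a b} → Reach p a b → g a ≡ g b
  reach-invariant g g-p (zero  , refl) = refl
  reach-invariant {p} g g-p {a} (suc j , refl) =
    trans (reach-invariant g g-p (j , refl)) (sym (g-p (iter p j a)))

  reach-mono-on : ∀ {p q : A → A} (P : A → Set) → (∀ z → P z → P (p z)) →
                  (∀ c → P c → Reach q c (p c)) → ∀ {a b} → P a → Reach p a b → Reach q a b
  reach-mono-on {p} {q} P P-p q-p Pa (j , e) = go j Pa e
    where
    go : ∀ j {a b} → P a → iter p j a ≡ b → Reach q a b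
    go zero    Pa refl = reach-refl
    go (suc j) {a} Pa refl = reach-trans (q-p a Pa) (go j (P-p a Pa) (sym (iter-suc p j a)))

  -- The p-path from u to t stays in P and meets t only at its end, so q follows it.
  reach-transfer : DecidableEquality A → ∀ {p q : A → A} (P : A → Set) → (∀ z → P z → P (p z)) →
                   ∀ {t} → (∀ z → P z → z ≢ t → q z ≡ p z) → ∀ {u} → P u → Reach p u t → Reach q u t
  reach-transfer _≟_ {p} {q} P P-p {t} agree Pu (j , e) = go j Pu e
    where
    go : ∀ j {u} → P u → iter p j u ≡ t → Reach q u t
    go zero    Pu refl = reach-refl
    go (suc j) {u} Pu e with u ≟ t
    ... | yes u≡t = 0 , u≡t
    ... | no  u≢t = reach-trans (reach-step (agree u Pu u≢t)) (go j (P-p u Pu) (trans (sym (iter-suc p j u)) e))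

module Transposition {A : Set} (_≟_ : DecidableEquality A) where

  transpose : A → A → A → A
  transpose x y z with z ≟ x
  ... | yes _ = y
  ... | no  _ with z ≟ y
  ...   | yes _ = x
  ...   | no  _ = z

  transpose-cases : ∀ x y z (P : A → Set) → (z ≡ x → P y) → (z ≡ y → P x) →
                    (z ≢ x → z ≢ y → P z) → P (transpose x y z)
  transpose-cases x y z P on-x on-y off with z ≟ x
  ... | yes z≡x = on-x z≡x
  ... | no  z≢x with z ≟ y
  ...   | yes z≡y = on-y z≡y
  ...   | no  z≢y = off z≢x z≢y

  transpose-x : ∀ x y → transpose x y x ≡ y
  transpose-x x y = transpose-cases x y x (_≡ y) (λ _ → refl) (λ x≡y → x≡y) (λ x≢x _ → ⊥-elim (x≢x refl))

  transpose-y : ∀ x y → transpose x y y ≡ x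
  transpose-y x y = transpose-cases x y y (_≡ x) (λ y≡x → y≡x) (λ _ → refl) (λ _ y≢y → ⊥-elim (y≢y refl))

  transpose-other : ∀ x y z → z ≢ x → z ≢ y → transpose x y z ≡ z
  transpose-other x y z z≢x z≢y =
    transpose-cases x y z (_≡ z) (⊥-elim ∘ z≢x) (⊥-elim ∘ z≢y) (λ _ _ → refl)

  transpose-involutive : ∀ x y z → transpose x y (transpose x y z) ≡ z
  transpose-involutive x y z = transpose-cases x y z (λ w → transpose x y w ≡ z)
    (λ { refl → transpose-y z y }) (λ { refl → transpose-x x z }) (transpose-other x y z)

module Identify {k : ℕ} (i j : Fin (suc k)) (i≢j : i ≢ j) where

  redirect : Fin (suc k) → Fin (suc k)
  redirect l with l Fin.≟ i
  ... | yes _ = j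
  ... | no  _ = l

  redirect-i : redirect i ≡ j
  redirect-i with i Fin.≟ i
  ... | yes _   = refl
  ... | no  i≢i = ⊥-elim (i≢i refl)

  redirect-other : ∀ l → l ≢ i → redirect l ≡ l
  redirect-other l l≢i with l Fin.≟ i
  ... | yes l≡i = ⊥-elim (l≢i l≡i)
  ... | no  _   = refl

  redirect-≢ : ∀ l → i ≢ redirect l
  redirect-≢ l with l Fin.≟ i
  ... | yes _   = i≢j
  ... | no  l≢i = l≢i ∘ sym

  InPair : Fin (suc k) → Set
  InPair l = l ≡ i ⊎ l ≡ j

  redirect-injective : ∀ {l l′} → redirect l ≡ redirect l′ → l ≡ l′ ⊎ InPair l × InPair l′
  redirect-injective {l} {l′} e with l Fin.≟ i | l′ Fin.≟ i
  ... | yes l≡i | yes l′≡i = inj₁ (trans l≡i (sym l′≡i))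
  ... | yes l≡i | no  _    = inj₂ (inj₁ l≡i , inj₂ (sym e))
  ... | no  _   | yes l′≡i = inj₂ (inj₂ e , inj₁ l′≡i)
  ... | no  _   | no  _    = inj₁ e

  identify : Fin (suc k) → Fin k
  identify l = punchOut (redirect-≢ l)

  identify-i≡j : identify i ≡ identify j
  identify-i≡j = punchOut-cong i (trans redirect-i (sym (redirect-other j (i≢j ∘ sym))))

  identify-injective : ∀ {l l′} → identify l ≡ identify l′ → l ≡ l′ ⊎ InPair l × InPair l′
  identify-injective {l} {l′} e = redirect-injective (punchOut-injective (redirect-≢ l) (redirect-≢ l′) e)

  identify-punchIn : ∀ o → identify (punchIn i o) ≡ o
  identify-punchIn o =
    trans (punchOut-cong i (redirect-other (punchIn i o) (punchInᵢ≢i i o))) (punchOut-punchIn i)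

module MergeOrbits {A : Set} (_≟_ : DecidableEquality A) {p : A → A} {k : ℕ}
                   (orbits : Orbits p (suc k)) (x y : A) (fx≢fy : proj₁ orbits x ≢ proj₁ orbits y) where
  open Transposition _≟_

  private
    f = proj₁ orbits

    same-orbit : ∀ {a b} → f a ≡ f b → Reach p a b
    same-orbit {a} {b} = proj₁ (proj₁ (proj₂ orbits) a b)

    f-p : ∀ a → f (p a) ≡ f a
    f-p a = sym (proj₂ (proj₁ (proj₂ orbits) a (p a)) (reach-step refl))

  p′ : A → A
  p′ = p ∘ transpose x y

  private
    returns : ∀ {a o} → f o ≢ f a → (∀ z → z ≢ a → z ≢ o → p′ z ≡ p z) → Reach p′ (p a) a
    returns {a} {o} fo≢fa agree = reach-transfer _≟_ (λ z → f z ≡ f a) (λ z e → trans (f-p z) e)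
      (λ z fz≡fa z≢a → agree z z≢a (λ z≡o → fo≢fa (trans (cong f (sym z≡o)) fz≡fa)))
      (f-p a) (same-orbit (f-p a))

    p′-other : ∀ z → z ≢ x → z ≢ y → p′ z ≡ p z
    p′-other z z≢x z≢y = cong p (transpose-other x y z z≢x z≢y)

  reach-x-y : Reach p′ x y
  reach-x-y = reach-trans (reach-step (cong p (transpose-x x y)))
                          (returns fx≢fy (λ z z≢y z≢x → p′-other z z≢x z≢y))

  reach-y-x : Reach p′ y x
  reach-y-x = reach-trans (reach-step (cong p (transpose-y x y))) (returns (fx≢fy ∘ sym) p′-other)

  private
    reach-p : ∀ c → Reach p′ c (p c)
    reach-p c with c ≟ x | c ≟ y
    ... | yes refl | _        = reach-trans reach-x-y (reach-step (cong p (transpose-y x y)))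
    ... | no  _    | yes refl = reach-trans reach-y-x (reach-step (cong p (transpose-x x y)))
    ... | no  c≢x  | no  c≢y  = reach-step (p′-other c c≢x c≢y)

    lift : ∀ {a b} → Reach p a b → Reach p′ a b
    lift = reach-mono-on (λ _ → ⊤) _ (λ c _ → reach-p c) tt

    open Identify (f y) (f x) (fx≢fy ∘ sym)

    f′ : A → Fin k
    f′ = identify ∘ f

    f′-p′ : ∀ z → f′ (p′ z) ≡ f′ z
    f′-p′ z = trans (cong identify (f-p (transpose x y z)))
      (transpose-cases x y z (λ w → identify (f w) ≡ identify (f z))
        (λ { refl → identify-i≡j }) (λ { refl → sym identify-i≡j }) (λ _ _ → refl))

    to-x : ∀ {a} → InPair (f a) → Reach p′ a x
    to-x (inj₁ fa≡fy) = reach-trans (lift (same-orbit fa≡fy)) reach-y-x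
    to-x (inj₂ fa≡fx) = lift (same-orbit fa≡fx)

    from-x : ∀ {b} → InPair (f b) → Reach p′ x b
    from-x (inj₁ fb≡fy) = reach-trans reach-x-y (lift (same-orbit (sym fb≡fy)))
    from-x (inj₂ fb≡fx) = lift (same-orbit (sym fb≡fx))

    f′-classifies : ∀ a b → f′ a ≡ f′ b → Reach p′ a b
    f′-classifies a b e with identify-injective e
    ... | inj₁ fa≡fb            = lift (same-orbit fa≡fb)
    ... | inj₂ (in-a , in-b) = reach-trans (to-x in-a) (from-x in-b)

    f′-onto : ∀ o → ∃[ a ] f′ a ≡ o
    f′-onto o with proj₂ (proj₂ orbits) (punchIn (f y) o)
    ... | a , fa≡ = a , trans (cong identify fa≡) (identify-punchIn o)

  merged-orbits : Orbits p′ k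
  merged-orbits = f′ , (λ a b → f′-classifies a b , reach-invariant f′ f′-p′) , f′-onto

module Classes {A : Set} {_~_ : A → A → Set} (isDecEquivalence : IsDecEquivalence _~_)
               (xs : List A) (xs-complete : ∀ a → a ∈ xs) where
  open IsDecEquivalence isDecEquivalence renaming (refl to ~-refl; sym to ~-sym; trans to ~-trans)

  Representatives : List A → Set
  Representatives L = Σ ℕ λ k → Σ (Fin k → A) λ rep →
    (∀ i j → rep i ~ rep j → i ≡ j) × (∀ a → a ∈ L → ∃[ i ] rep i ~ a)

  representatives : ∀ L → Representatives L
  representatives [] = 0 , (λ ()) , (λ ()) , (λ _ ())
  representatives (a ∷ L) with representatives L
  ... | k , rep , distinct , covers with any? (λ i → rep i ≟ a)
  ...   | yes (i , rep-i~a) = k , rep , distinct , covers′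
    where
    covers′ : ∀ b → b ∈ a ∷ L → ∃[ i ] rep i ~ b
    covers′ b (here refl) = i , rep-i~a
    covers′ b (there b∈L) = covers b b∈L
  ...   | no ¬rep~a = suc k , rep′ , distinct′ , covers′
    where
    rep′ : Fin (suc k) → A
    rep′ zero    = a
    rep′ (suc i) = rep i
    distinct′ : ∀ i j → rep′ i ~ rep′ j → i ≡ j
    distinct′ zero    zero    _ = refl
    distinct′ zero    (suc j) a~ = ⊥-elim (¬rep~a (j , ~-sym a~))
    distinct′ (suc i) zero    ~a = ⊥-elim (¬rep~a (i , ~a))
    distinct′ (suc i) (suc j) ~  = cong suc (distinct i j ~)
    covers′ : ∀ b → b ∈ a ∷ L → ∃[ i ] rep′ i ~ b
    covers′ b (here refl) = zero , ~-refl
    covers′ b (there b∈L) with covers b b∈L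
    ... | i , rep-i~b = suc i , rep-i~b

  classification : Σ ℕ (Classification _~_)
  classification with representatives xs
  ... | k , rep , distinct , covers = k , class , (λ a b → class-sound a b , class-complete a b) , onto
    where
    class : A → Fin k
    class a = proj₁ (covers a (xs-complete a))
    rep-class : ∀ a → rep (class a) ~ a
    rep-class a = proj₂ (covers a (xs-complete a))
    class-sound : ∀ a b → class a ≡ class b → a ~ b
    class-sound a b e = ~-trans (~-sym (rep-class a)) (subst (λ i → rep i ~ b) (sym e) (rep-class b))
    class-complete : ∀ a b → a ~ b → class a ≡ class b
    class-complete a b a~b = distinct _ _ (~-trans (rep-class a) (~-trans a~b (~-sym (rep-class b))))
    onto : ∀ i → ∃[ a ] class a ≡ i
    onto i = rep i , distinct _ _ (rep-class (rep i))

module Finite {A : Set} {N : ℕ} (fin : Fin N ↩ A) where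
  open LeftInverse fin using (to; from; strictlyInverseˡ)

  from-injective : ∀ {a b} → from a ≡ from b → a ≡ b
  from-injective {a} {b} e = trans (sym (strictlyInverseˡ a)) (trans (cong to e) (strictlyInverseˡ b))

  _≟_ : DecidableEquality A
  a ≟ b = map′ from-injective (cong from) (from a Fin.≟ from b)

  elements : List A
  elements = map to (allFin N)

  ∈-elements : ∀ a → a ∈ elements
  ∈-elements a = subst (_∈ elements) (strictlyInverseˡ a) (∈-map⁺ to (∈-allFin (from a)))

  module Permutation (p q : A → A) (q∘p : ∀ a → q (p a) ≡ a) where

    iter-injective : ∀ i {a b} → iter p i a ≡ iter p i b → a ≡ b
    iter-injective zero    e = e
    iter-injective (suc i) e = iter-injective i (trans (sym (q∘p _)) (trans (cong q e) (q∘p _)))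

    period : ∀ a → ∃[ d ] iter p (suc d) a ≡ a
    period a with pigeonhole (n<1+n N) (λ i → from (iter p (toℕ i) a))
    ... | i , j , i<j , e with m≤n⇒∃[o]m+o≡n i<j
    ... | d , i+1+d≡j = d , iter-injective (toℕ i) (begin
      iter p (toℕ i) (iter p (suc d) a)  ≡⟨ iter-+ p (toℕ i) (suc d) a ⟨
      iter p (toℕ i + suc d) a           ≡⟨ cong (λ l → iter p l a) (trans (+-suc (toℕ i) d) i+1+d≡j) ⟩
      iter p (toℕ j) a                   ≡⟨ from-injective e ⟨
      iter p (toℕ i) a                   ∎)
      where open ≡-Reasoning

    iter-period-multiple : ∀ {a} d → iter p (suc d) a ≡ a → ∀ c → iter p (c * suc d) a ≡ a
    iter-period-multiple d e zero    = refl
    iter-period-multiple {a} d e (suc c) =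
      trans (iter-+ p (suc d) (c * suc d) a) (trans (cong (iter p (suc d)) (iter-period-multiple d e c)) e)

    reach-sym : ∀ {a b} → Reach p a b → Reach p b a
    reach-sym {a} (j , refl) with period a
    ... | d , e = j * d , (begin
      iter p (j * d) (iter p j a)  ≡⟨ iter-+ p (j * d) j a ⟨
      iter p (j * d + j) a         ≡⟨ cong (λ l → iter p l a) (trans (+-comm (j * d) j) (sym (*-suc j d))) ⟩
      iter p (j * suc d) a         ≡⟨ iter-period-multiple d e j ⟩
      a                            ∎)
      where open ≡-Reasoning

    iter-mod-period : ∀ {a} d → iter p (suc d) a ≡ a → ∀ j → iter p (j % suc d) a ≡ iter p j a
    iter-mod-period {a} d e j = begin
      iter p r a                         ≡⟨ cong (iter p r) (iter-period-multiple d e k) ⟨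
      iter p r (iter p (k * suc d) a)    ≡⟨ iter-+ p r (k * suc d) a ⟨
      iter p (r + k * suc d) a           ≡⟨ cong (λ l → iter p l a) (m≡m%n+[m/n]*n j (suc d)) ⟨
      iter p j a                         ∎
      where
      open ≡-Reasoning
      r = j % suc d
      k = j / suc d

    reach? : ∀ a b → Dec (Reach p a b)
    reach? a b with period a
    ... | d , e with any? (λ (i : Fin (suc d)) → iter p (toℕ i) a ≟ b)
    ... | yes (i , e′) = yes (toℕ i , e′)
    ... | no  ¬short   = no λ { (j , e′) → ¬short (fromℕ< (m%n<n j (suc d)) ,
            trans (cong (λ l → iter p l a) (toℕ-fromℕ< (m%n<n j (suc d)))) (trans (iter-mod-period d e j) e′)) }

    orbits : Σ ℕ (Orbits p)
    orbits = Classes.classification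
      (record { isEquivalence = record { refl = reach-refl ; sym = reach-sym ; trans = reach-trans }
              ; _≟_ = reach? })
      elements ∈-elements

  record FibreCycle {C : Set} (h : A → C) : Set where
    field
      σ σ⁻¹           : A → A
      σ∘σ⁻¹           : ∀ a → σ (σ⁻¹ a) ≡ a
      σ⁻¹∘σ           : ∀ a → σ⁻¹ (σ a) ≡ a
      h∘σ             : ∀ a → h (σ a) ≡ h a
      fibre-connected : ∀ a b → h a ≡ h b → Reach σ a b

  module _ {C : Set} (_≟C_ : DecidableEquality C) (h : A → C) where
    open Transposition _≟_
    open import Data.List.Membership.DecPropositional _≟_ using (_∈?_)

    private
      firstIn : C → List A → A → A
      firstIn v []      d = d
      firstIn v (e ∷ L) d with h e ≟C v
      ... | yes _ = e
      ... | no  _ = firstIn v L d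

      h-firstIn : ∀ v L d → h d ≡ v → h (firstIn v L d) ≡ v
      h-firstIn v []      d hd≡v = hd≡v
      h-firstIn v (e ∷ L) d hd≡v with h e ≟C v
      ... | yes he≡v = he≡v
      ... | no  _    = h-firstIn v L d hd≡v

      firstIn-irrelevant : ∀ v L d d′ {e} → e ∈ L → h e ≡ v → firstIn v L d ≡ firstIn v L d′
      firstIn-irrelevant v (e ∷ L) d d′ e∈ he≡v with h e ≟C v
      firstIn-irrelevant v (e ∷ L) d d′ e∈          he≡v | yes _   = refl
      firstIn-irrelevant v (e ∷ L) d d′ (here refl) he≡v | no ¬he≡v = ⊥-elim (¬he≡v he≡v)
      firstIn-irrelevant v (e ∷ L) d d′ (there e∈)  he≡v | no _     = firstIn-irrelevant v L d d′ e∈ he≡v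

      rep : A → A
      rep c = firstIn (h c) elements c

      h-rep : ∀ c → h (rep c) ≡ h c
      h-rep c = h-firstIn (h c) elements c refl

      rep-cong : ∀ {c c′} → h c ≡ h c′ → rep c ≡ rep c′
      rep-cong {c} {c′} e = trans (cong (λ v → firstIn v elements c) e)
                                  (firstIn-irrelevant (h c′) elements c c′ (∈-elements c′) refl)

      rep-idempotent : ∀ c → rep (rep c) ≡ rep c
      rep-idempotent c = rep-cong (h-rep c)

      record PartialCycle (L : List A) : Set where
        field
          σ σ⁻¹   : A → A
          σ∘σ⁻¹   : ∀ a → σ (σ⁻¹ a) ≡ a
          σ⁻¹∘σ   : ∀ a → σ⁻¹ (σ a) ≡ a
          h∘σ     : ∀ a → h (σ a) ≡ h a
          reaches : ∀ c → c ∈ L → Reach σ (rep c) c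
          fixes   : ∀ c → c ∉ L → c ≢ rep c → σ c ≡ c

      add-reached : ∀ {L a} (S : PartialCycle L) → Reach (PartialCycle.σ S) (rep a) a → PartialCycle (a ∷ L)
      add-reached {L} {a} S reach-a = record
        { PartialCycle S hiding (reaches; fixes)
        ; reaches = λ { c (here refl) → reach-a ; c (there c∈L) → reaches c c∈L }
        ; fixes   = λ c c∉ → fixes c (c∉ ∘ there) }
        where open PartialCycle S

      -- Splices a, fixed so far, into the cycle of σ through its representative.
      insert : ∀ {L a} (S : PartialCycle L) → a ∉ L → a ≢ rep a → PartialCycle (a ∷ L)
      insert {L} {a} S a∉L a≢r = record
        { σ       = σ ∘ transpose r a
        ; σ⁻¹     = transpose r a ∘ σ⁻¹
        ; σ∘σ⁻¹   = λ z → trans (cong σ (transpose-involutive r a (σ⁻¹ z))) (σ∘σ⁻¹ z)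
        ; σ⁻¹∘σ   = λ z → trans (cong (transpose r a) (σ⁻¹∘σ (transpose r a z))) (transpose-involutive r a z)
        ; h∘σ     = λ z → trans (h∘σ _) (transpose-cases r a z (λ w → h w ≡ h z)
                            (λ { refl → sym (h-rep a) }) (λ { refl → h-rep a }) (λ _ _ → refl))
        ; reaches = reaches′
        ; fixes   = fixes′ }
        where
        open PartialCycle S
        r = rep a

        σa≡a : σ a ≡ a
        σa≡a = fixes a a∉L a≢r

        σr≡a : σ (transpose r a r) ≡ a
        σr≡a = trans (cong σ (transpose-x r a)) σa≡a

        σ-avoids-a : ∀ z → z ≢ a → σ z ≢ a
        σ-avoids-a z z≢a σz≡a =
          z≢a (trans (sym (σ⁻¹∘σ z)) (trans (cong σ⁻¹ (trans σz≡a (sym σa≡a))) (σ⁻¹∘σ a)))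

        step : ∀ z → z ≢ a → Reach (σ ∘ transpose r a) z (σ z)
        step z z≢a with z ≟ r
        ... | yes refl = reach-trans (reach-step σr≡a) (reach-step (cong σ (transpose-y z a)))
        ... | no  z≢r  = reach-step (cong σ (transpose-other r a z z≢r z≢a))

        reaches′ : ∀ c → c ∈ a ∷ L → Reach (σ ∘ transpose r a) (rep c) c
        reaches′ c (here refl) = reach-step σr≡a
        reaches′ c (there c∈L) = reach-mono-on (_≢ a) σ-avoids-a step rep-c≢a (reaches c c∈L)
          where
          rep-c≢a : rep c ≢ a
          rep-c≢a e = a≢r (trans (sym e) (trans (sym (rep-idempotent c)) (cong rep e)))

        fixes′ : ∀ c → c ∉ a ∷ L → c ≢ rep c → σ (transpose r a c) ≡ c
        fixes′ c c∉ c≢rep-c =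
          trans (cong σ (transpose-other r a c c≢r (c∉ ∘ here))) (fixes c (c∉ ∘ there) c≢rep-c)
          where
          c≢r : c ≢ r
          c≢r c≡r = c≢rep-c (trans c≡r (trans (sym (rep-idempotent a)) (cong rep (sym c≡r))))

      partialCycle : ∀ L → PartialCycle L
      partialCycle []      = record
        { σ = λ z → z ; σ⁻¹ = λ z → z ; σ∘σ⁻¹ = λ _ → refl ; σ⁻¹∘σ = λ _ → refl ; h∘σ = λ _ → refl
        ; reaches = λ _ () ; fixes = λ _ _ _ → refl }
      partialCycle (a ∷ L) with partialCycle L | a ∈? L | a ≟ rep a
      ... | S | yes a∈L | _      = add-reached S (PartialCycle.reaches S a a∈L)
      ... | S | no  _   | yes a≡r = add-reached S (0 , sym a≡r)
      ... | S | no  a∉L | no  a≢r = insert S a∉L a≢r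

    fibreCycle : FibreCycle h
    fibreCycle = record
      { PartialCycle S hiding (reaches; fixes)
      ; fibre-connected = λ a b ha≡hb →
          reach-trans (reach-sym (reaches a (∈-elements a)))
                      (subst (λ r → Reach σ r b) (sym (rep-cong ha≡hb)) (reaches b (∈-elements b))) }
      where
      S = partialCycle elements
      open PartialCycle S
      open Permutation σ σ⁻¹ σ⁻¹∘σ using (reach-sym)

module ListCycle {A : Set} (_≟_ : DecidableEquality A) where
  open Transposition _≟_

  -- cycle (c₀ ∷ … ∷ cₗ) maps cᵢ to cᵢ₊₁ and cₗ to c₀.
  cycle : List A → A → A
  cycle []           z = z
  cycle (c ∷ [])     z = z
  cycle (c ∷ c′ ∷ L) z = transpose c c′ (cycle (c′ ∷ L) z)

  cycle⁻¹ : List A → A → A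
  cycle⁻¹ []           z = z
  cycle⁻¹ (c ∷ [])     z = z
  cycle⁻¹ (c ∷ c′ ∷ L) z = cycle⁻¹ (c′ ∷ L) (transpose c c′ z)

  cycle-cycle⁻¹ : ∀ L z → cycle L (cycle⁻¹ L z) ≡ z
  cycle-cycle⁻¹ []           z = refl
  cycle-cycle⁻¹ (c ∷ [])     z = refl
  cycle-cycle⁻¹ (c ∷ c′ ∷ L) z =
    trans (cong (transpose c c′) (cycle-cycle⁻¹ (c′ ∷ L) (transpose c c′ z))) (transpose-involutive c c′ z)

  cycle⁻¹-cycle : ∀ L z → cycle⁻¹ L (cycle L z) ≡ z
  cycle⁻¹-cycle []           z = refl
  cycle⁻¹-cycle (c ∷ [])     z = refl
  cycle⁻¹-cycle (c ∷ c′ ∷ L) z =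
    trans (cong (cycle⁻¹ (c′ ∷ L)) (transpose-involutive c c′ (cycle (c′ ∷ L) z))) (cycle⁻¹-cycle (c′ ∷ L) z)

  cycle-injective : ∀ L {z z′} → cycle L z ≡ cycle L z′ → z ≡ z′
  cycle-injective L {z} {z′} e = trans (sym (cycle⁻¹-cycle L z)) (trans (cong (cycle⁻¹ L) e) (cycle⁻¹-cycle L z′))

  cycle-∉ : ∀ L z → z ∉ L → cycle L z ≡ z
  cycle-∉ []           z _   = refl
  cycle-∉ (c ∷ [])     z _   = refl
  cycle-∉ (c ∷ c′ ∷ L) z z∉ = trans (cong (transpose c c′) (cycle-∉ (c′ ∷ L) z (z∉ ∘ there)))
                                    (transpose-other c c′ z (z∉ ∘ here) (z∉ ∘ there ∘ here))

flipSide-involutive : ∀ {m} (x : Side m) → flipSide (flipSide x) ≡ x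
flipSide-involutive (e , b) = cong (e ,_) (not-involutive b)

sideRetract : ∀ {m} → Fin (m + m) ↩ Side m
sideRetract {m} = mk↩ {to = decode} {from = encode} (strictlyInverseˡ⇒inverseˡ decode decode-encode)
  where
  encode : Side m → Fin (m + m)
  encode (e , true)  = e ↑ˡ m
  encode (e , false) = m ↑ʳ e
  decode : Fin (m + m) → Side m
  decode i = [ (_, true) , (_, false) ]′ (splitAt m i)
  decode-encode : ∀ x → decode (encode x) ≡ x
  decode-encode (e , true)  = cong [ (_, true) , (_, false) ]′ (splitAt-↑ˡ m e m)
  decode-encode (e , false) = cong [ (_, true) , (_, false) ]′ (splitAt-↑ʳ m m e)

∈-↭-allFin : ∀ {m} {w : List (Fin m)} → w ↭ allFin m → ∀ e → e ∈ w
∈-↭-allFin w↭ e = ∈-resp-↭ (↭-sym w↭) (∈-allFin e)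

module Embeddings {n m : ℕ} (D : Digraph n m) where
  open Digraph D
  open Finite (sideRetract {m}) using (_≟_)
  open Transposition _≟_

  faceOrbits : (E : DirectedEmbedding D) → Σ ℕ (FaceOrbits D E)
  faceOrbits E = Finite.Permutation.orbits sideRetract (φ E) (ψ E) (ψφ E)

  reach-flip⇒¬orientable : ∀ E x → Reach (φ E) x (flipSide x) → ¬ Orientable D E
  reach-flip⇒¬orientable E x x→flip-x (c , c-φ , c-flip) = c-flip x (sym (reach-invariant c c-φ x→flip-x))

  twist : DirectedEmbedding D → Side m → DirectedEmbedding D
  twist E x = record
    { φ          = φ′
    ; ψ          = ψ′
    ; φψ         = λ z → trans (cong (φ E) (transpose-involutive x x̄ (ψ E z))) (φψ E z)
    ; ψφ         = λ z → trans (cong t (ψφ E (t z))) (transpose-involutive x x̄ z)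
    ; directed   = λ z → trans (cong head (sym (arcOf-t z))) (directed E (t z))
    ; vertexDisk = λ v a b ha hb → (corner ⋆) (vertexDisk E v a b ha hb)
    }
    where
    x̄ = flipSide x
    t = transpose x x̄
    φ′ ψ′ : Side m → Side m
    φ′ = φ E ∘ t
    ψ′ = t ∘ ψ E
    arcOf-t : ∀ z → arcOf (t z) ≡ arcOf z
    arcOf-t z =
      transpose-cases x x̄ z (λ w → arcOf w ≡ arcOf z) (cong arcOf ∘ sym) (cong arcOf ∘ sym) (λ _ _ → refl)
    Corners′ = Star (CornerStep φ′ ψ′)
    across : Side m → Side m
    across u = ψ E (flipSide (φ E u))
    swapped : ∀ u → Corners′ u (t u)
    swapped u = transpose-cases x x̄ u (Corners′ u)
      (λ { refl → inj₁ refl ◅ ε }) (λ { refl → inj₁ (sym (flipSide-involutive x)) ◅ ε }) (λ _ _ → ε)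
    unswapped : ∀ w → Corners′ (t w) w
    unswapped w = subst (Corners′ (t w)) (transpose-involutive x x̄ w) (swapped (t w))
    -- A corner step u ↦ across u of E becomes a flip to t u, a twisted corner step, and a flip back.
    corner : ∀ {u w} → CornerStep (φ E) (ψ E) u w → Corners′ u w
    corner (inj₁ e)        = inj₁ e ◅ ε
    corner {u} (inj₂ refl) = swapped u ◅◅
      (inj₂ (cong (λ s → t (across s)) (sym (transpose-involutive x x̄ u))) ◅ unswapped (across u))

  -- The corners at a vertex are linked by flips and face steps, and the Euler circuit links the vertices.
  module _ (E : DirectedEmbedding D) {X : Set} (g : Side m → X)
           (g-φ : ∀ z → g (φ E z) ≡ g z) (g-flip : ∀ z → g (flipSide z) ≡ g z) where
    private
      g-ψ : ∀ z → g (ψ E z) ≡ g z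
      g-ψ z = trans (sym (g-φ (ψ E z))) (cong g (φψ E z))

      g-corner : ∀ {a b} → CornerStep (φ E) (ψ E) a b → g a ≡ g b
      g-corner {a} (inj₁ refl) = sym (g-flip a)
      g-corner {a} (inj₂ refl) = sym (trans (g-ψ _) (trans (g-flip _) (g-φ a)))

      g-corners : ∀ {a b} → Star (CornerStep (φ E) (ψ E)) a b → g a ≡ g b
      g-corners = fold (λ a b → g a ≡ g b) (λ step rest → trans (g-corner step) rest) refl

      g-consecutive : ∀ e e′ → tail e′ ≡ head e → g (e , true) ≡ g (e′ , true)
      g-consecutive e e′ te′≡he =
        trans (g-corners (vertexDisk E (head e) (e , true) z refl hz))
              (trans (sym (g-φ z)) (cong g (φψ E (e′ , true))))
        where
        z = ψ E (e′ , true)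
        hz : head (arcOf z) ≡ head e
        hz = trans (directed E z) (trans (cong (tail ∘ arcOf) (φψ E (e′ , true))) te′≡he)

      g-walk : ∀ {v u} e w → WalkFromTo D v (e ∷ w) u → ∀ {e′} → e′ ∈ e ∷ w → g (e′ , true) ≡ g (e , true)
      g-walk e w        _           (here refl) = refl
      g-walk e (e₂ ∷ w) (_ , walk) (there e′∈) =
        trans (g-walk e₂ w walk e′∈) (sym (g-consecutive e e₂ (proj₁ walk)))

      g-side : ∀ z → g z ≡ g (arcOf z , true)
      g-side (e , true)  = refl
      g-side (e , false) = g-flip (e , true)

    faceFlipInvariant⇒constant : Eulerian D → ∀ z z′ → g z ≡ g z′
    faceFlipInvariant⇒constant (v₀ , []    , _      , w↭ , _) z z′ with () ← ∈-↭-allFin w↭ (arcOf z)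
    faceFlipInvariant⇒constant (v₀ , e ∷ w , closed , w↭ , _) z z′ =
      trans (trans (g-side z) (g-walk e w closed (∈-↭-allFin w↭ (arcOf z))))
            (sym (trans (g-side z′) (g-walk e w closed (∈-↭-allFin w↭ (arcOf z′)))))

  mergeFaces : Eulerian D → (E : DirectedEmbedding D) → ∀ {k} → FaceOrbits D E (suc (suc k)) →
               Σ (DirectedEmbedding D) λ E′ → FaceOrbits D E′ (suc k) × ¬ Orientable D E′
  mergeFaces eul E orbits@(f , classify , onto) with any? (λ e → ¬? (f (e , true) Fin.≟ f (e , false)))
  ... | yes (e , sides-differ) = twist E x , merged-orbits , reach-flip⇒¬orientable (twist E x) x reach-x-y
    where
    x = (e , true)
    open MergeOrbits _≟_ orbits x (flipSide x) sides-differ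
  ... | no ¬sides-differ with onto zero | onto (suc zero)
  ...   | a , fa≡0 | b , fb≡1 = ⊥-elim (0≢1+n (trans (sym fa≡0) (trans (f-constant a b) fb≡1)))
    where
    sides-agree : ∀ e → f (e , true) ≡ f (e , false)
    sides-agree e = decidable-stable (f (e , true) Fin.≟ f (e , false)) (λ ne → ¬sides-differ (e , ne))
    f-flip : ∀ z → f (flipSide z) ≡ f z
    f-flip (e , true)  = sym (sides-agree e)
    f-flip (e , false) = sides-agree e
    f-φ : ∀ z → f (φ E z) ≡ f z
    f-φ z = sym (proj₂ (classify z (φ E z)) (reach-step refl))
    f-constant : ∀ z z′ → f z ≡ f z′
    f-constant = faceFlipInvariant⇒constant E f f-φ f-flip eul

module EulerCircuitEmbedding {n m : ℕ} (D : Digraph n m) where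
  open Digraph D
  open Transposition (Fin._≟_ {m})
  open ListCycle (Fin._≟_ {m})

  cycle-walk : ∀ {u v} c L → WalkFromTo D u (c ∷ L) v → Unique (c ∷ L) → ∀ {z} → z ∈ c ∷ L →
               (head z ≡ tail (cycle (c ∷ L) z) × cycle (c ∷ L) z ≢ c) ⊎ (head z ≡ v × cycle (c ∷ L) z ≡ c)
  cycle-walk c []       (_ , hc≡v) _ (here refl) = inj₂ (hc≡v , refl)
  cycle-walk c (c′ ∷ L) (_ , walk) (c≢ ∷ _) (here refl) =
    inj₁ (trans (sym (proj₁ walk)) (cong tail (sym cycle-c)) , λ e → All.head c≢ (trans (sym e) cycle-c))
    where
    cycle-c : cycle (c ∷ c′ ∷ L) c ≡ c′
    cycle-c = trans (cong (transpose c c′) (cycle-∉ (c′ ∷ L) c (All¬⇒¬Any c≢))) (transpose-x c c′)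
  cycle-walk c (c′ ∷ L) (_ , walk) (c≢ ∷ unique) {z} (there z∈) with cycle-walk c′ L walk unique z∈
  ... | inj₁ (hz≡ , y≢c′) = inj₁ (trans hz≡ (cong tail (sym fixed)) , λ e → y≢c (trans (sym fixed) e))
    where
    y = cycle (c′ ∷ L) z
    y≢c : y ≢ c
    y≢c e = All¬⇒¬Any c≢ (subst (_∈ c′ ∷ L)
              (cycle-injective (c′ ∷ L) (trans e (sym (cycle-∉ (c′ ∷ L) c (All¬⇒¬Any c≢))))) z∈)
    fixed : transpose c c′ y ≡ y
    fixed = transpose-other c c′ y y≢c y≢c′
  ... | inj₂ (hz≡v , y≡c′) = inj₂ (hz≡v , trans (cong (transpose c c′) y≡c′) (transpose-y c c′))

  closed-walk-cycle : ∀ {v} w → WalkFromTo D v w v → Unique w → ∀ {e} → e ∈ w → head e ≡ tail (cycle w e)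
  closed-walk-cycle (c ∷ L) closed unique e∈ with cycle-walk c L closed unique e∈
  ... | inj₁ (he≡ , _)    = he≡
  ... | inj₂ (he≡v , e↦c) = trans he≡v (trans (sym (proj₁ closed)) (cong tail (sym e↦c)))

  -- True sides follow the Euler circuit; false sides are rotated at each vertex by a fibre cycle of head.
  module EulerEmbedding (v₀ : Fin n) (w : List (Fin m)) (closed : WalkFromTo D v₀ w v₀) (w↭ : w ↭ allFin m) where
    next prev : Fin m → Fin m
    next = cycle w
    prev = cycle⁻¹ w

    next-directed : ∀ e → head e ≡ tail (next e)
    next-directed e =
      closed-walk-cycle w closed (↭ₛ.Unique-resp-↭ (setoid _) (↭⇒↭ₛ (↭-sym w↭)) (allFin⁺ m)) (∈-↭-allFin w↭ e)

    open Finite.FibreCycle (Finite.fibreCycle (↩-id (Fin m)) Fin._≟_ head)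

    φ₀ ψ₀ : Side m → Side m
    φ₀ (a , true)  = (next a , true)
    φ₀ (a , false) = (next (σ a) , false)
    ψ₀ (c , true)  = (prev c , true)
    ψ₀ (c , false) = (σ⁻¹ (prev c) , false)

    Corners₀ = Star (CornerStep φ₀ ψ₀)

    σ-path : ∀ j a → Corners₀ (a , true) (iter σ j a , true)
    σ-path zero    a = ε
    σ-path (suc j) a = σ-path j a ◅◅ (inj₁ refl ◅ inj₂ (cong (_, true) (sym (cycle⁻¹-cycle w _))) ◅ ε)

    to-true : ∀ z → Corners₀ z (arcOf z , true)
    to-true (a , true)  = ε
    to-true (a , false) = inj₁ refl ◅ ε

    from-true : ∀ z → Corners₀ (arcOf z , true) z
    from-true (a , true)  = ε
    from-true (a , false) = inj₁ refl ◅ ε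

    embedding : DirectedEmbedding D
    embedding = record
      { φ          = φ₀
      ; ψ          = ψ₀
      ; φψ         = λ { (c , true)  → cong (_, true) (cycle-cycle⁻¹ w c)
                       ; (c , false) → cong (_, false) (trans (cong next (σ∘σ⁻¹ _)) (cycle-cycle⁻¹ w c)) }
      ; ψφ         = λ { (a , true)  → cong (_, true) (cycle⁻¹-cycle w a)
                       ; (a , false) → cong (_, false) (trans (cong σ⁻¹ (cycle⁻¹-cycle w _)) (σ⁻¹∘σ a)) }
      ; directed   = λ { (a , true) → next-directed a ; (a , false) → trans (sym (h∘σ a)) (next-directed (σ a)) }
      ; vertexDisk = vertexDisk₀
      }
      where
      vertexDisk₀ : ∀ v x y → head (arcOf x) ≡ v → head (arcOf y) ≡ v → Corners₀ x y
      vertexDisk₀ v x y hx hy with fibre-connected (arcOf x) (arcOf y) (trans hx (sym hy))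
      ... | j , e =
        to-true x ◅◅ subst (λ a → Corners₀ (arcOf x , true) (a , true)) e (σ-path j (arcOf x)) ◅◅ from-true y

eulerEmbedding : ∀ {n m} (D : Digraph n m) → Eulerian D → DirectedEmbedding D
eulerEmbedding D (v₀ , w , closed , w↭ , _) = EulerCircuitEmbedding.EulerEmbedding.embedding D v₀ w closed w↭

module Genus {n m : ℕ} (D : Digraph n m) where
  private
    c : ℤ
    c = + (2 + m) ℤ.- + n

    -‿+ : ∀ a b t → a ℤ.- (b ℤ.+ t) ≡ (a ℤ.- b) ℤ.- t
    -‿+ = solve-∀

  eulerGenus-linear : ∀ t → eulerGenus D t ≡ c ℤ.- + t
  eulerGenus-linear t = trans (cong (λ z → + (2 + m) ℤ.- z) (ℤₚ.pos-+ n t)) (-‿+ (+ (2 + m)) (+ n) (+ t))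

  eulerGenus-1 : eulerGenus D 1 ≡ (+ m ℤ.- + n) ℤ.+ + 1
  eulerGenus-1 = trans (eulerGenus-linear 1) (lemma (+ m) (+ n))
    where
    lemma : ∀ a b → ((+ 2 ℤ.+ a) ℤ.- b) ℤ.- + 1 ≡ (a ℤ.- b) ℤ.+ + 1
    lemma = solve-∀

  eulerGenus-+ : ∀ t d → eulerGenus D (t + d) ≡ eulerGenus D t ℤ.- + d
  eulerGenus-+ t d = begin
    eulerGenus D (t + d)         ≡⟨ eulerGenus-linear (t + d) ⟩
    c ℤ.- + (t + d)              ≡⟨ cong (λ z → c ℤ.- z) (ℤₚ.pos-+ t d) ⟩
    c ℤ.- (+ t ℤ.+ + d)          ≡⟨ -‿+ c (+ t) (+ d) ⟩
    (c ℤ.- + t) ℤ.- + d          ≡⟨ cong (ℤ._- + d) (eulerGenus-linear t) ⟨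
    eulerGenus D t ℤ.- + d       ∎
    where open ≡-Reasoning

  eulerGenus-antitone : ∀ {s t} → s ≤ t → eulerGenus D t ℤ.≤ eulerGenus D s
  eulerGenus-antitone {s} {t} s≤t = subst₂ ℤ._≤_ (sym (eulerGenus-linear t)) (sym (eulerGenus-linear s))
    (ℤₚ.+-monoʳ-≤ c (ℤₚ.neg-mono-≤ (ℤ.+≤+ s≤t)))

  eulerGenus-cancel-≤ : ∀ {s t} → eulerGenus D s ℤ.≤ eulerGenus D t → t ≤ s
  eulerGenus-cancel-≤ {s} {t} G≤G with t ≤? s
  ... | yes t≤s = t≤s
  ... | no  t≰s = ⊥-elim (ℤₚ.<⇒≱ (subst₂ ℤ._<_ (sym (eulerGenus-linear t)) (sym (eulerGenus-linear s))
                    (ℤₚ.+-monoʳ-< c (ℤₚ.neg-mono-< (ℤ.+<+ (≰⇒> t≰s))))) G≤G)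

  eulerGenus-between : ∀ {t₁ t₂ g} → eulerGenus D t₁ ℤ.≤ g → g ℤ.≤ eulerGenus D t₂ →
                       ∃[ s ] t₂ ≤ s × s ≤ t₁ × eulerGenus D s ≡ g
  eulerGenus-between {t₁} {t₂} {g} G₁≤g g≤G₂ =
    t₂ + d , m≤m+n t₂ d , eulerGenus-cancel-≤ (subst (eulerGenus D t₁ ℤ.≤_) (sym G≡g) G₁≤g) , G≡g
    where
    d = ∣ eulerGenus D t₂ ℤ.- g ∣
    +d≡G₂-g : + d ≡ eulerGenus D t₂ ℤ.- g
    +d≡G₂-g = ℤₚ.0≤i⇒+∣i∣≡i (ℤₚ.i≤j⇒0≤j-i g≤G₂)
    G≡g : eulerGenus D (t₂ + d) ≡ g
    G≡g = begin
      eulerGenus D (t₂ + d)                        ≡⟨ eulerGenus-+ t₂ d ⟩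
      eulerGenus D t₂ ℤ.- + d                      ≡⟨ cong (λ z → eulerGenus D t₂ ℤ.- z) +d≡G₂-g ⟩
      eulerGenus D t₂ ℤ.- (eulerGenus D t₂ ℤ.- g)  ≡⟨ lemma (eulerGenus D t₂) g ⟩
      g                                            ∎
      where
      open ≡-Reasoning
      lemma : ∀ a b → a ℤ.- (a ℤ.- b) ≡ b
      lemma = solve-∀

T-allᵇ : ∀ {A : Set} (p : A → Bool) {xs x} → T (allᵇ p xs) → x ∈ xs → T (p x)
T-allᵇ p {y ∷ _} t (here refl) with p y
... | true = tt
T-allᵇ p {y ∷ _} t (there x∈) with p y
... | true = T-allᵇ p t x∈

module NoIsolatedVertices {n m : ℕ} (D : Digraph n (suc m)) where
  open Digraph D

  incident : Eulerian D → ∀ v → ∃[ e ] (tail e ≡ v ⊎ head e ≡ v)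
  incident (v₀ , []    , _      , w↭ , _)      v with () ← ∈-↭-allFin w↭ zero
  incident (v₀ , c ∷ w , closed , w↭ , covers) v with covers v
  ... | inj₁ refl = c , inj₁ (proj₁ closed)
  ... | inj₂ some with satisfied some
  ...   | e , he≡v = e , inj₂ he≡v

  incident⇒¬isolated : ∀ e v → tail e ≡ v ⊎ head e ≡ v → ¬ T (isIsolated D v)
  incident⇒¬isolated e v incidence isolated = subst T (not-incident incidence) (T-allᵇ _ isolated (∈-allFin e))
    where
    not-incident : tail e ≡ v ⊎ head e ≡ v → not (⌊ tail e Fin.≟ v ⌋ ∨ ⌊ head e Fin.≟ v ⌋) ≡ false
    not-incident (inj₁ te≡v) with tail e Fin.≟ v
    ... | yes _    = refl
    ... | no  te≢v = ⊥-elim (te≢v te≡v)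
    not-incident (inj₂ he≡v) with tail e Fin.≟ v | head e Fin.≟ v
    ... | yes _ | _        = refl
    ... | no  _ | yes _    = refl
    ... | no  _ | no  he≢v = ⊥-elim (he≢v he≡v)

  isolatedCount≡0 : Eulerian D → isolatedCount D ≡ 0
  isolatedCount≡0 eul = cong length (filter-none {P = λ v → T (isIsolated D v)} (λ v → T? (isIsolated D v))
    {allFin n} (All.tabulate λ {v} _ → let (e , incidence) = incident eul v in
                                        incident⇒¬isolated e v incidence))

module WithArcs {n m : ℕ} (D : Digraph n (suc m)) (eul : Eulerian D) where
  open Embeddings D
  open Genus D

  private
    E₀ : DirectedEmbedding D
    E₀ = eulerEmbedding D eul

    k+isolated≡k : ∀ k → k + isolatedCount D ≡ k
    k+isolated≡k k = trans (cong (λ i → k + i) (NoIsolatedVertices.isolatedCount≡0 D eul)) (+-identityʳ k)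

  hasFaces⇒faceOrbits : ∀ E {t} → HasFaces D E t → FaceOrbits D E t
  hasFaces⇒faceOrbits E (k , orbits , t≡) = subst (FaceOrbits D E) (sym (trans t≡ (k+isolated≡k k))) orbits

  faceOrbits⇒hasFaces : ∀ E {k} → FaceOrbits D E k → HasFaces D E k
  faceOrbits⇒hasFaces E {k} orbits = k , orbits , sym (k+isolated≡k k)

  hasFaces⇒1≤ : ∀ E {t} → HasFaces D E t → 1 ≤ t
  hasFaces⇒1≤ E faces = ≤-trans (s≤s z≤n) (toℕ<n (proj₁ (hasFaces⇒faceOrbits E faces) (zero , true)))

  mergeFaces⋆ : ∀ d {s} E → FaceOrbits D E (suc d + suc s) →
                Σ (DirectedEmbedding D) λ E′ → FaceOrbits D E′ (suc s) × ¬ Orientable D E′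
  mergeFaces⋆ zero    E orbits = mergeFaces eul E orbits
  mergeFaces⋆ (suc d) E orbits with mergeFaces eul E orbits
  ... | E′ , orbits′ , _ = mergeFaces⋆ d E′ orbits′

  fewerFaces : (E : DirectedEmbedding D) (t : ℕ) → HasFaces D E t → (s : ℕ) → 1 ≤ s → s < t →
               Σ (DirectedEmbedding D) λ E′ → HasFaces D E′ s × ¬ Orientable D E′
  fewerFaces E t faces (suc s) _ s<t with m≤n⇒∃[o]m+o≡n s<t
  ... | d , refl
    with mergeFaces⋆ d E (subst (FaceOrbits D E) (cong suc (+-comm (suc s) d)) (hasFaces⇒faceOrbits E faces))
  ...   | E′ , orbits′ , ¬orientable = E′ , faceOrbits⇒hasFaces E′ orbits′ , ¬orientable

  mergeToOneFace : ∀ E {k} → FaceOrbits D E k → Σ (DirectedEmbedding D) λ E′ → HasFaces D E′ 1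
  mergeToOneFace E {k} orbits with m≤n⇒m<n∨m≡n (hasFaces⇒1≤ E (faceOrbits⇒hasFaces E orbits))
  ... | inj₂ refl = E , faceOrbits⇒hasFaces E orbits
  ... | inj₁ 1<k with fewerFaces E k (faceOrbits⇒hasFaces E orbits) 1 ≤-refl 1<k
  ...   | E′ , faces , _ = E′ , faces

  oneFaceEmbedding : Σ (DirectedEmbedding D) λ E → HasFaces D E 1
  oneFaceEmbedding = mergeToOneFace E₀ (proj₂ (faceOrbits E₀))

  oneFace⇒¬orientable : ∀ E → HasFaces D E 1 → ¬ Orientable D E
  oneFace⇒¬orientable E faces with hasFaces⇒faceOrbits E faces
  ... | f , classify , _ = reach-flip⇒¬orientable E x (proj₁ (classify x (flipSide x)) (Fin1-equal _ _))
    where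
    x = (zero , true)
    Fin1-equal : (i j : Fin 1) → i ≡ j
    Fin1-equal zero zero = refl

  eulerGenus≤oneFace : ∀ E t → HasFaces D E t → eulerGenus D t ℤ.≤ eulerGenus D 1
  eulerGenus≤oneFace E t faces = eulerGenus-antitone (hasFaces⇒1≤ E faces)

  nonorientableGenus-interval : (g₁ g₂ g : ℤ) → HasNonorientableGenus D g₁ → HasNonorientableGenus D g₂ →
                                g₁ ℤ.≤ g → g ℤ.≤ g₂ → HasNonorientableGenus D g
  nonorientableGenus-interval _ _ g (E₁ , t₁ , faces₁ , ¬or₁ , refl) (E₂ , t₂ , faces₂ , _ , refl) g₁≤g g≤g₂
    with eulerGenus-between g₁≤g g≤g₂
  ... | s , t₂≤s , s≤t₁ , G≡g with m≤n⇒m<n∨m≡n s≤t₁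
  ...   | inj₂ refl = E₁ , s , faces₁ , ¬or₁ , G≡g
  ...   | inj₁ s<t₁ with fewerFaces E₁ t₁ faces₁ s (≤-trans (hasFaces⇒1≤ E₂ faces₂) t₂≤s) s<t₁
  ...     | E , faces , ¬orientable = E , s , faces , ¬orientable , G≡g

no-arcs⇒single-vertex : ∀ {n} (D : Digraph n 0) → Eulerian D → n ≡ 1
no-arcs⇒single-vertex {zero}        D (() , _)
no-arcs⇒single-vertex {suc zero}    D _ = refl
no-arcs⇒single-vertex {suc (suc n)} D (v₀ , w , _ , w↭ , covers) with ↭-empty-inv w↭
... | refl with covers zero | covers (suc zero)
...   | inj₁ refl | inj₁ ()
...   | inj₂ ()   | _
...   | _         | inj₂ ()

module NoArcs (D : Digraph 1 0) where

  embedding : DirectedEmbedding D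
  embedding = record
    { φ = λ z → z ; ψ = λ z → z ; φψ = λ _ → refl ; ψφ = λ _ → refl
    ; directed = λ { (() , _) } ; vertexDisk = λ { _ (() , _) } }

  all-same : ∀ E₁ E₂ → SameEmbedding D E₁ E₂
  all-same E₁ E₂ = (λ ()) , λ { (() , _) }

  orientable : ∀ E → Orientable D E
  orientable E = (λ _ → true) , (λ { (() , _) }) , λ { (() , _) }

  planar : ∀ E → Planar D E 1
  planar E = orientable E , refl

  oneFace : ∀ E → HasFaces D E 1
  oneFace E = 0 , ((λ { (() , _) }) , (λ { (() , _) }) , λ ()) , refl

  hasFaces⇒≡1 : ∀ E {t} → HasFaces D E t → t ≡ 1
  hasFaces⇒≡1 E (zero  , _ , t≡) = t≡
  hasFaces⇒≡1 E (suc k , (_ , _ , onto) , _) with onto zero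
  ... | (() , _) , _

  fewerFaces : (E : DirectedEmbedding D) (t : ℕ) → HasFaces D E t → (s : ℕ) → 1 ≤ s → s < t →
               Σ (DirectedEmbedding D) λ E′ → HasFaces D E′ s × ¬ Orientable D E′
  fewerFaces E t faces s 1≤s s<t with hasFaces⇒≡1 E faces
  fewerFaces E t faces (suc s) 1≤s (s≤s ()) | refl

  nonorientableGenus-interval : (g₁ g₂ g : ℤ) → HasNonorientableGenus D g₁ → HasNonorientableGenus D g₂ →
                                g₁ ℤ.≤ g → g ℤ.≤ g₂ → HasNonorientableGenus D g
  nonorientableGenus-interval _ _ _ (E , _ , _ , ¬orientable , _) _ _ _ = ⊥-elim (¬orientable (orientable E))

theorem7p3 : (n m : ℕ) (D : Digraph n m) → Eulerian D →
  ((E : DirectedEmbedding D) (t : ℕ) → HasFaces D E t →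
    (s : ℕ) → 1 ≤ s → s < t →
    Σ (DirectedEmbedding D) λ E' → HasFaces D E' s × ¬ Orientable D E')
  × ((g₁ g₂ g : ℤ) → HasNonorientableGenus D g₁ → HasNonorientableGenus D g₂ →
    g₁ ℤ.≤ g → g ℤ.≤ g₂ → HasNonorientableGenus D g)
  × (m ≡ 0 →
    DirectedEmbedding D
    × ((E₁ E₂ : DirectedEmbedding D) → SameEmbedding D E₁ E₂)
    × ((E : DirectedEmbedding D) → Planar D E 1 × HasFaces D E 1))
  × (m ≥ 1 →
    (Σ (DirectedEmbedding D) λ E → HasFaces D E 1)
    × ((E : DirectedEmbedding D) → HasFaces D E 1 →
      ¬ Orientable D E
      × nonorientableGenus D 1 ≡ (+ m ℤ.- + n) ℤ.+ + 1
      × ((E' : DirectedEmbedding D) (t' : ℕ) → HasFaces D E' t' → ¬ Orientable D E' →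
        nonorientableGenus D t' ℤ.≤ nonorientableGenus D 1)
      × ((E' : DirectedEmbedding D) (t' : ℕ) → HasFaces D E' t' →
        eulerGenus D t' ℤ.≤ eulerGenus D 1)))
theorem7p3 n zero D eul with no-arcs⇒single-vertex D eul
... | refl = fewerFaces , nonorientableGenus-interval ,
             (λ _ → embedding , all-same , λ E → planar E , oneFace E) , λ ()
  where open NoArcs D
theorem7p3 n (suc m) D eul =
  fewerFaces , nonorientableGenus-interval , (λ ()) ,
  λ _ → oneFaceEmbedding ,
        λ E faces → oneFace⇒¬orientable E faces , eulerGenus-1 ,
                    (λ E′ t′ faces′ _ → eulerGenus≤oneFace E′ t′ faces′) , eulerGenus≤oneFace
  where
  open WithArcs D eul
  open Genus D
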